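{- Suppose $u=u_1\cdots u_n$ and $v=v_1\cdots v_n$ in $\mathbb{P}^*$ satisfy $u\sim_s v$. Then for any $k\in\mathbb{P}$, $u_1^k u_2^k\cdots u_n^k\sim_s v_1^k v_2^k\cdots v_n^k$, where $b^k$ denotes the word consisting of $k$ copies of $b$.
   Context: $\mathbb{P}$ is the positive integers; $\mathbb{P}^*$ the finite words over $\mathbb{P}$. Generalized factor order: $u\le w$ iff there is a factor $w'$ of $w$ (consecutive letters) with $|w'|=|u|$ and $u_i\le w'_i$ for all $i$; if $w'$ starts at the $j$th letter of $w$, $j$ is an embedding index, and $\mathrm{Em}(u,w)$ is the set of these. The weight of $w=w_1\cdots w_\ell$ is $t^\ell x^{w_1+\cdots+w_\ell}$. $u\sim_s v$ (strong Wilf equivalence) means there is a weight-preserving bijection $f:\mathbb{P}^*\to\mathbb{P}^*$ with $\mathrm{Em}(u,w)=\mathrm{Em}(v,f(w))$ for all $w$. -}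

module Defs where

open import Data.Nat using (ℕ; zero; suc; _+_; _≤_)
open import Data.List using (List; []; _∷_; length; map; drop; take; replicate; concatMap)
open import Data.List.Relation.Binary.Pointwise using (Pointwise)
open import Data.Product using (Σ; _×_; _,_)
open import Data.Nat.ListAction using (sum)
open import Function.Bundles using (_⤖_; _⇔_; Bijection)
open import Relation.Binary.PropositionalEquality using (_≡_)

-- A letter of ℙ (the positive integers) is encoded by a natural number a,
-- standing for the positive integer  suc a  (i.e. a + 1).
Letter : Set
Letter = ℕ

val : Letter → ℕ
val a = suc a

Word : Set
Word = List Letter

_≤ℓ_ : Letter → Letter → Set
a ≤ℓ b = val a ≤ val b

-- j is an embedding index of u into w: the factor w' of w starting at
-- position j (0-based here; the paper is 1-based, a uniform shift) has
-- |w'| = |u| and u_i ≤ w'_i for all i.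
IsEmbeddingIndex : Word → Word → ℕ → Set
IsEmbeddingIndex u w j =
  (length u + j ≤ length w) × Pointwise _≤ℓ_ u (take (length u) (drop j w))

-- weight t^ℓ x^{w_1+⋯+w_ℓ}, recorded as the pair (ℓ , w_1+⋯+w_ℓ)
weight : Word → ℕ × ℕ
weight w = length w , sum (map val w)

_∼s_ : Word → Word → Set
u ∼s v =
  Σ (Word ⤖ Word) λ f →
    ((w : Word) → weight (Bijection.to f w) ≡ weight w) ×
    ((w : Word) (j : ℕ) →
       IsEmbeddingIndex u w j ⇔ IsEmbeddingIndex v (Bijection.to f w) j)

stretch : ℕ → Word → Word
stretch k = concatMap (replicate k)

-- Deal a word into K = suc k piles, the i-th pile holding its letters at positions
-- ≡ i (mod K).  The stretched word u₁^K ⋯ uₙ^K deals into K copies of u, and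
-- j is an embedding index of it in w exactly when, in every pile of w, the
-- index corresponding to j is an embedding index of u.  Applying a bijection
-- that witnesses u ∼s v to each pile separately therefore preserves weight and
-- carries these conditions over to v.
module Submission where

open import Defs
open import Data.Nat.ListAction using (sum)
open import Data.Nat using (ℕ; zero; suc; _+_; _≤_; z≤n; s≤s; s≤s⁻¹)
open import Data.Nat.Properties using (+-suc; +-assoc; suc-injective; +-commutativeSemigroup)
open import Algebra.Properties.CommutativeSemigroup +-commutativeSemigroup using (x∙yz≈y∙xz)
open import Data.Nat.GeneralisedArithmetic using (fold)
open import Data.List as List using (List; []; _∷_; length; _++_; replicate)
open import Data.List.Properties using (++-assoc; ++-identityʳ; ∷ʳ-injective)
open import Data.List.Relation.Binary.Pointwise using ([]; _∷_)
open import Data.Vec as Vec using (Vec; []; _∷_; _∷ʳ_; init; last; initLast; toList)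
open import Data.Vec.Properties
  using ( cast-is-id; map-∘; map-cong; map-id; map-replicate; init-∷ʳ; last-∷ʳ
        ; toList-injective; toList-∷ʳ; toList-map; length-toList)
open import Data.Vec.Relation.Binary.Pointwise.Inductive using (Pointwise; []; _∷_)
open import Data.Product using (_×_; _,_; proj₁; proj₂)
open import Data.Empty using (⊥-elim)
open import Function.Base using (_∘_)
open import Function.Bundles using (_⇔_; _↔_; Bijection; Equivalence; Inverse; mk⇔; mk↔ₛ′)
open import Function.Properties.Bijection using (⤖⇒↔)
open import Function.Properties.Inverse using (↔⇒⤖)
import Function.Properties.Equivalence as ⇔
open import Function.Related.Propositional using (module EquationalReasoning)
open import Relation.Nullary using (¬_)
open import Relation.Binary.PropositionalEquality

private
  variable
    A B C : Set
    n : ℕ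

open Equivalence using (to; from)

rotate : (A → A) → Vec A (suc n) → Vec A (suc n)
rotate f xs = f (last xs) ∷ init xs

init-∷ʳ-last : (xs : Vec A (suc n)) → init xs ∷ʳ last xs ≡ xs
init-∷ʳ-last xs = sym (proj₂ (proj₂ (initLast xs)))

rotate-∷ʳ : (f : A → A) (xs : Vec A n) (x : A) → rotate f (xs ∷ʳ x) ≡ f x ∷ xs
rotate-∷ʳ f xs x = cong₂ (λ y ys → f y ∷ ys) (last-∷ʳ x xs) (init-∷ʳ x xs)

toList-rotate : (f : A → A) (xs : Vec A (suc n)) {ys : List A} {y : A} →
  toList xs ≡ ys List.∷ʳ y → toList (rotate f xs) ≡ f y ∷ ys
toList-rotate f xs {ys} {y} eq =
  let init≡ys , last≡y = ∷ʳ-injective (toList (init xs)) ys toList-split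
  in cong₂ (λ z zs → f z ∷ zs) last≡y init≡ys
  where
  toList-split : toList (init xs) List.∷ʳ last xs ≡ ys List.∷ʳ y
  toList-split = trans (sym (toList-∷ʳ (last xs) (init xs))) (trans (cong toList (init-∷ʳ-last xs)) eq)

-- Stated for lists, since the vector version would equate Vec A (m + n) with Vec A (n + m).
toList-fold-rotate : (f : A → A) (xs ys : List A) (zs : Vec A (suc n)) →
  toList zs ≡ ys ++ xs → toList (fold zs (rotate f) (length xs)) ≡ List.map f xs ++ ys
toList-fold-rotate f [] ys zs eq = trans eq (++-identityʳ ys)
toList-fold-rotate f (x ∷ xs) ys zs eq =
  toList-rotate f (fold zs (rotate f) (length xs))
    (trans (toList-fold-rotate f xs (ys List.∷ʳ x) zs (trans eq (sym (++-assoc ys (x ∷ []) xs))))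
           (sym (++-assoc (List.map f xs) ys (x ∷ []))))

fold-rotate-length : (f : A → A) (xs : Vec A (suc n)) → fold xs (rotate f) (suc n) ≡ Vec.map f xs
fold-rotate-length {n = n} f xs =
  trans (sym (cast-is-id refl _)) (toList-injective refl _ _ (begin
  toList (fold xs (rotate f) (suc n))               ≡⟨ cong (toList ∘ fold xs (rotate f)) (length-toList xs) ⟨
  toList (fold xs (rotate f) (length (toList xs)))  ≡⟨ toList-fold-rotate f (toList xs) [] xs refl ⟩
  List.map f (toList xs) ++ []                      ≡⟨ ++-identityʳ _ ⟩
  List.map f (toList xs)                            ≡⟨ toList-map f xs ⟨
  toList (Vec.map f xs)                             ∎))
  where open ≡-Reasoning

Pointwise-initLast : {R : A → B → Set} {xs : Vec A (suc n)} {ys : Vec B (suc n)} →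
  Pointwise R xs ys ⇔ (Pointwise R (init xs) (init ys) × R (last xs) (last ys))
Pointwise-initLast {n = zero} {xs = _ ∷ []} {_ ∷ []} =
  mk⇔ (λ { (r ∷ []) → [] , r }) (λ { ([] , r) → r ∷ [] })
Pointwise-initLast {n = suc n} {xs = _ ∷ _} {_ ∷ _} =
  mk⇔ (λ { (r ∷ rs) → let inits , lasts = to Pointwise-initLast rs in r ∷ inits , lasts })
      (λ { (r ∷ inits , lasts) → r ∷ from Pointwise-initLast (inits , lasts) })

Pointwise-replicateˡ : {R : A → B → Set} {x : A} → (∀ {y} → R x y) → {ys : Vec B n} →
  Pointwise R (Vec.replicate n x) ys
Pointwise-replicateˡ Rx {[]} = []
Pointwise-replicateˡ Rx {_ ∷ _} = Rx ∷ Pointwise-replicateˡ Rx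

Pointwise-∷ʳ⁺ : {R : A → B → Set} {xs : Vec A n} {ys : Vec B n} {x : A} {y : B} →
  Pointwise R xs ys → R x y → Pointwise R (xs ∷ʳ x) (ys ∷ʳ y)
Pointwise-∷ʳ⁺ [] r = r ∷ []
Pointwise-∷ʳ⁺ (r′ ∷ rs) r = r′ ∷ Pointwise-∷ʳ⁺ rs r

Pointwise-rotate : {R : A → B → Set} {f : A → A} {g : B → B} →
  (∀ {x y} → R x y ⇔ R (f x) (g y)) → {xs : Vec A (suc n)} {ys : Vec B (suc n)} →
  Pointwise R xs ys ⇔ Pointwise R (rotate f xs) (rotate g ys)
Pointwise-rotate R⇔fRg =
  mk⇔ (λ rs → let inits , lasts = to Pointwise-initLast rs in to R⇔fRg lasts ∷ inits)
      (λ { (r ∷ inits) → from Pointwise-initLast (inits , from R⇔fRg r) })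

Pointwise-replicate-flip : {R : A → B → Set} {S : B → C → Set} {x : A} {z : C} →
  (∀ {y} → R x y ⇔ S y z) → {ys : Vec B n} →
  Pointwise R (Vec.replicate n x) ys ⇔ Pointwise S ys (Vec.replicate n z)
Pointwise-replicate-flip {n = zero} R⇔S {[]} = mk⇔ (λ _ → []) (λ _ → [])
Pointwise-replicate-flip {n = suc n} R⇔S {_ ∷ _} =
  mk⇔ (λ { (r ∷ rs) → to R⇔S r ∷ to (Pointwise-replicate-flip R⇔S) rs })
      (λ { (s ∷ ss) → from R⇔S s ∷ from (Pointwise-replicate-flip R⇔S) ss })

Pointwise-mapˡ : {R : A → B → Set} {S : C → B → Set} {f : A → C} →
  (∀ {x y} → R x y ⇔ S (f x) y) → {xs : Vec A n} {ys : Vec B n} →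
  Pointwise R xs ys ⇔ Pointwise S (Vec.map f xs) ys
Pointwise-mapˡ R⇔S {[]} {[]} = mk⇔ (λ _ → []) (λ _ → [])
Pointwise-mapˡ R⇔S {_ ∷ _} {_ ∷ _} =
  mk⇔ (λ { (r ∷ rs) → to R⇔S r ∷ to (Pointwise-mapˡ R⇔S) rs })
      (λ { (s ∷ ss) → from R⇔S s ∷ from (Pointwise-mapˡ R⇔S) ss })

sum-map-last-init : (μ : A → ℕ) (xs : Vec A (suc n)) →
  Vec.sum (Vec.map μ xs) ≡ μ (last xs) + Vec.sum (Vec.map μ (init xs))
sum-map-last-init μ (x ∷ []) = refl
sum-map-last-init μ (x ∷ y ∷ xs) =
  trans (cong (μ x +_) (sum-map-last-init μ (y ∷ xs)))
        (x∙yz≈y∙xz (μ x) (μ (last (y ∷ xs))) (Vec.sum (Vec.map μ (init (y ∷ xs)))))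

SameLength : List A → List A → Set
SameLength p q = length p ≡ length q

SameLength-replicate-[] : {ps : Vec (List A) n} →
  Pointwise SameLength ps (Vec.replicate n []) → ps ≡ Vec.replicate n []
SameLength-replicate-[] [] = refl
SameLength-replicate-[] {ps = [] ∷ _} (_ ∷ sames) = cong ([] ∷_) (SameLength-replicate-[] sames)
SameLength-replicate-[] {ps = (_ ∷ _) ∷ _} (() ∷ _)

infix 4 _≼_

_≼_ : Word → Word → Set
u ≼ w = IsEmbeddingIndex u w 0

[]≼ : (w : Word) → [] ≼ w
[]≼ w = z≤n , []

∷≼∷ : {a x : Letter} {u w : Word} → (a ∷ u) ≼ (x ∷ w) ⇔ (a ≤ℓ x × u ≼ w)
∷≼∷ = mk⇔ (λ { (s≤s |u|≤|w| , a≤x ∷ u≤w) → a≤x , (|u|≤|w| , u≤w) })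
          (λ { (a≤x , (|u|≤|w| , u≤w)) → s≤s |u|≤|w| , a≤x ∷ u≤w })

embedding-∷-suc : (u : Word) (x : Letter) (w : Word) (j : ℕ) →
  IsEmbeddingIndex u (x ∷ w) (suc j) ⇔ IsEmbeddingIndex u w j
embedding-∷-suc u x w j =
  mk⇔ (λ (fits , u≤w) → s≤s⁻¹ (subst (_≤ suc (length w)) (+-suc (length u) j) fits) , u≤w)
      (λ (fits , u≤w) → subst (_≤ suc (length w)) (sym (+-suc (length u) j)) (s≤s fits) , u≤w)

¬embedding-[]-suc : {u : Word} {j : ℕ} → ¬ IsEmbeddingIndex u [] (suc j)
¬embedding-[]-suc {u} {j} (fits , _) with subst (_≤ 0) (+-suc (length u) j) fits
... | ()

module Dealing (k : ℕ) where

  deal : List A → Vec (List A) (suc k)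
  deal [] = Vec.replicate (suc k) []
  deal (x ∷ w) = rotate (x ∷_) (deal w)

  deal-replicate-++ : (a : A) (m : ℕ) (w : List A) →
    deal (replicate m a ++ w) ≡ fold (deal w) (rotate (a ∷_)) m
  deal-replicate-++ a zero w = refl
  deal-replicate-++ a (suc m) w = cong (rotate (a ∷_)) (deal-replicate-++ a m w)

  deal-stretch : (u : Word) → deal (stretch (suc k) u) ≡ Vec.replicate (suc k) u
  deal-stretch [] = refl
  deal-stretch (a ∷ u) = begin
    deal (replicate (suc k) a ++ stretch (suc k) u)
      ≡⟨ deal-replicate-++ a (suc k) _ ⟩
    fold (deal (stretch (suc k) u)) (rotate (a ∷_)) (suc k)
      ≡⟨ cong (λ D → fold D (rotate (a ∷_)) (suc k)) (deal-stretch u) ⟩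
    fold (Vec.replicate (suc k) u) (rotate (a ∷_)) (suc k)
      ≡⟨ fold-rotate-length (a ∷_) _ ⟩
    Vec.map (a ∷_) (Vec.replicate (suc k) u)
      ≡⟨ map-replicate (a ∷_) u (suc k) ⟩
    Vec.replicate (suc k) (a ∷ u)
      ∎
    where open ≡-Reasoning

  ≼⇔deal≼deal : (p w : Word) → p ≼ w ⇔ Pointwise _≼_ (deal p) (deal w)
  ≼⇔deal≼deal [] w = mk⇔ (λ _ → Pointwise-replicateˡ (λ {W} → []≼ W)) (λ _ → []≼ w)
  ≼⇔deal≼deal (a ∷ p) [] = mk⇔ (λ ()) (λ { ((() , _) ∷ _) })
  ≼⇔deal≼deal (a ∷ p) (x ∷ w) = mk⇔ ⇒ ⇐
    where
    ⇒ : (a ∷ p) ≼ (x ∷ w) → Pointwise _≼_ (deal (a ∷ p)) (deal (x ∷ w))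
    ⇒ a∷p≼x∷w =
      let a≤x , p≼w = to ∷≼∷ a∷p≼x∷w
          inits , lasts = to Pointwise-initLast (to (≼⇔deal≼deal p w) p≼w)
      in from ∷≼∷ (a≤x , lasts) ∷ inits
    ⇐ : Pointwise _≼_ (deal (a ∷ p)) (deal (x ∷ w)) → (a ∷ p) ≼ (x ∷ w)
    ⇐ (heads ∷ inits) =
      let a≤x , lasts = to ∷≼∷ heads
      in from ∷≼∷ (a≤x , from (≼⇔deal≼deal p w) (from Pointwise-initLast (inits , lasts)))

  -- Entry i counts the positions below j that are ≡ i (mod suc k), so a factor
  -- of w starting at position j starts at that entry in the i-th pile.
  pileIndices : ℕ → Vec ℕ (suc k)
  pileIndices zero = Vec.replicate (suc k) 0
  pileIndices (suc j) = rotate suc (pileIndices j)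

  embedding-stretch : (u w : Word) (j : ℕ) →
    IsEmbeddingIndex (stretch (suc k) u) w j ⇔ Pointwise (IsEmbeddingIndex u) (deal w) (pileIndices j)
  embedding-stretch u w zero = begin
    stretch (suc k) u ≼ w
      ∼⟨ ≼⇔deal≼deal (stretch (suc k) u) w ⟩
    Pointwise _≼_ (deal (stretch (suc k) u)) (deal w)
      ≡⟨ cong (λ D → Pointwise _≼_ D (deal w)) (deal-stretch u) ⟩
    Pointwise _≼_ (Vec.replicate (suc k) u) (deal w)
      ∼⟨ Pointwise-replicate-flip {S = IsEmbeddingIndex u} ⇔.refl ⟩
    Pointwise (IsEmbeddingIndex u) (deal w) (pileIndices 0)
      ∎
    where open EquationalReasoning
  embedding-stretch u [] (suc j) =
    mk⇔ (⊥-elim ∘ ¬embedding-[]-suc) (λ { (e ∷ _) → ⊥-elim (¬embedding-[]-suc e) })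
  embedding-stretch u (x ∷ w) (suc j) = begin
    IsEmbeddingIndex (stretch (suc k) u) (x ∷ w) (suc j)
      ∼⟨ embedding-∷-suc _ x w j ⟩
    IsEmbeddingIndex (stretch (suc k) u) w j
      ∼⟨ embedding-stretch u w j ⟩
    Pointwise (IsEmbeddingIndex u) (deal w) (pileIndices j)
      ∼⟨ Pointwise-rotate (λ {W t} → ⇔.sym (embedding-∷-suc u x W t)) ⟩
    Pointwise (IsEmbeddingIndex u) (deal (x ∷ w)) (pileIndices (suc j))
      ∎
    where open EquationalReasoning

  -- The ℕ argument is the number of letters to read back, column by column.
  undeal : ℕ → Vec (List A) (suc k) → List A
  undeal zero piles = []
  undeal (suc n) ([] ∷ piles) = []
  undeal (suc n) ((x ∷ pile) ∷ piles) = x ∷ undeal n (piles ∷ʳ pile)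

  undeal-deal : (w : List A) → undeal (length w) (deal w) ≡ w
  undeal-deal [] = refl
  undeal-deal (x ∷ w) =
    cong (x ∷_) (trans (cong (undeal (length w)) (init-∷ʳ-last (deal w))) (undeal-deal w))

  deal-undeal : (w : List A) (piles : Vec (List A) (suc k)) →
    Pointwise SameLength piles (deal w) → deal (undeal (length w) piles) ≡ piles
  deal-undeal [] piles sames = sym (SameLength-replicate-[] sames)
  deal-undeal (x ∷ w) ((y ∷ pile) ∷ piles) (same ∷ sames) = begin
    rotate (y ∷_) (deal (undeal (length w) (piles ∷ʳ pile)))
      ≡⟨ cong (rotate (y ∷_)) (deal-undeal w (piles ∷ʳ pile) sames′) ⟩
    rotate (y ∷_) (piles ∷ʳ pile)
      ≡⟨ rotate-∷ʳ (y ∷_) piles pile ⟩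
    (y ∷ pile) ∷ piles
      ∎
    where
    open ≡-Reasoning
    sames′ : Pointwise SameLength (piles ∷ʳ pile) (deal w)
    sames′ = subst (Pointwise SameLength (piles ∷ʳ pile)) (init-∷ʳ-last (deal w))
                   (Pointwise-∷ʳ⁺ sames (suc-injective same))

  module _ (μ : List A → ℕ) (c : A → ℕ)
           (μ-[] : μ [] ≡ 0) (μ-∷ : ∀ x w → μ (x ∷ w) ≡ c x + μ w) where

    sum-map-deal : (w : List A) → Vec.sum (Vec.map μ (deal w)) ≡ μ w
    sum-map-deal [] = trans (empty-piles (suc k)) (sym μ-[])
      where
      empty-piles : (n : ℕ) → Vec.sum (Vec.map μ (Vec.replicate n [])) ≡ 0
      empty-piles zero = refl
      empty-piles (suc n) = cong₂ _+_ μ-[] (empty-piles n)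
    sum-map-deal (x ∷ w) = begin
      μ (x ∷ last D) + Σ (init D)     ≡⟨ cong (_+ Σ (init D)) (μ-∷ x (last D)) ⟩
      c x + μ (last D) + Σ (init D)   ≡⟨ +-assoc (c x) _ _ ⟩
      c x + (μ (last D) + Σ (init D)) ≡⟨ cong (c x +_) (sum-map-last-init μ D) ⟨
      c x + Σ D                       ≡⟨ cong (c x +_) (sum-map-deal w) ⟩
      c x + μ w                       ≡⟨ μ-∷ x w ⟨
      μ (x ∷ w)                       ∎
      where
      open ≡-Reasoning
      D : Vec (List A) (suc k)
      D = deal w
      Σ : Vec (List A) n → ℕ
      Σ = Vec.sum ∘ Vec.map μ

  dealwise : (List A → List A) → List A → List A
  dealwise f w = undeal (length w) (Vec.map f (deal w))

  module _ {f : List A → List A} (f-length : ∀ w → length (f w) ≡ length w) where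

    deal-dealwise : (w : List A) → deal (dealwise f w) ≡ Vec.map f (deal w)
    deal-dealwise w = deal-undeal w _ (f-SameLength (deal w))
      where
      f-SameLength : (ws : Vec (List A) n) → Pointwise SameLength (Vec.map f ws) ws
      f-SameLength [] = []
      f-SameLength (w ∷ ws) = f-length w ∷ f-SameLength ws

    dealwise-preserves : (μ : List A → ℕ) (c : A → ℕ) →
      μ [] ≡ 0 → (∀ x w → μ (x ∷ w) ≡ c x + μ w) →
      (∀ w → μ (f w) ≡ μ w) → (w : List A) → μ (dealwise f w) ≡ μ w
    dealwise-preserves μ c μ-[] μ-∷ f-μ w = begin
      μ (dealwise f w)                       ≡⟨ sum-map-deal μ c μ-[] μ-∷ (dealwise f w) ⟨
      Vec.sum (Vec.map μ (deal (dealwise f w))) ≡⟨ cong (Vec.sum ∘ Vec.map μ) (deal-dealwise w) ⟩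
      Vec.sum (Vec.map μ (Vec.map f (deal w)))  ≡⟨ cong Vec.sum (map-∘ μ f (deal w)) ⟨
      Vec.sum (Vec.map (μ ∘ f) (deal w))        ≡⟨ cong Vec.sum (map-cong f-μ (deal w)) ⟩
      Vec.sum (Vec.map μ (deal w))              ≡⟨ sum-map-deal μ c μ-[] μ-∷ w ⟩
      μ w                                       ∎
      where open ≡-Reasoning

    length-dealwise : (w : List A) → length (dealwise f w) ≡ length w
    length-dealwise = dealwise-preserves length (λ _ → 1) refl (λ _ _ → refl) f-length

    dealwise-inverse : {g : List A → List A} → (∀ w → g (f w) ≡ w) →
      (w : List A) → dealwise g (dealwise f w) ≡ w
    dealwise-inverse {g} g∘f≗id w = begin
      undeal (length (dealwise f w)) (Vec.map g (deal (dealwise f w)))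
        ≡⟨ cong₂ (λ m D → undeal m (Vec.map g D)) (length-dealwise w) (deal-dealwise w) ⟩
      undeal (length w) (Vec.map g (Vec.map f (deal w)))
        ≡⟨ cong (undeal (length w)) g∘f-cancels ⟩
      undeal (length w) (deal w)
        ≡⟨ undeal-deal w ⟩
      w ∎
      where
      open ≡-Reasoning
      g∘f-cancels : Vec.map g (Vec.map f (deal w)) ≡ deal w
      g∘f-cancels = trans (sym (map-∘ g f (deal w))) (trans (map-cong g∘f≗id (deal w)) (map-id (deal w)))

  dealwise-↔ : (e : List A ↔ List A) → (∀ w → length (Inverse.to e w) ≡ length w) →
    List A ↔ List A
  dealwise-↔ e to-length =
    mk↔ₛ′ (dealwise e→) (dealwise e←) (dealwise-inverse e←-length strictlyInverseˡ)
          (dealwise-inverse to-length strictlyInverseʳ)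
    where
    open Inverse e renaming (to to e→; from to e←)
    e←-length : ∀ w → length (e← w) ≡ length w
    e←-length w = trans (sym (to-length (e← w))) (cong length (strictlyInverseˡ w))

  weight-dealwise : {f : Word → Word} → (∀ w → weight (f w) ≡ weight w) →
    (w : Word) → weight (dealwise f w) ≡ weight w
  weight-dealwise {f} f-weight w =
    cong₂ _,_ (length-dealwise f-length w)
              (dealwise-preserves f-length (λ w → sum (List.map val w)) val refl (λ _ _ → refl)
                                  (cong proj₂ ∘ f-weight) w)
    where
    f-length : ∀ w → length (f w) ≡ length w
    f-length = cong proj₁ ∘ f-weight

  embedding-stretch-dealwise : {u v : Word} {f : Word → Word} → (∀ w → length (f w) ≡ length w) →
    (∀ w j → IsEmbeddingIndex u w j ⇔ IsEmbeddingIndex v (f w) j) →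
    (w : Word) (j : ℕ) →
    IsEmbeddingIndex (stretch (suc k) u) w j ⇔ IsEmbeddingIndex (stretch (suc k) v) (dealwise f w) j
  embedding-stretch-dealwise {u} {v} {f} f-length f-embedding w j = begin
    IsEmbeddingIndex (stretch (suc k) u) w j
      ∼⟨ embedding-stretch u w j ⟩
    Pointwise (IsEmbeddingIndex u) (deal w) (pileIndices j)
      ∼⟨ Pointwise-mapˡ (f-embedding _ _) ⟩
    Pointwise (IsEmbeddingIndex v) (Vec.map f (deal w)) (pileIndices j)
      ≡⟨ cong (λ D → Pointwise (IsEmbeddingIndex v) D (pileIndices j)) (deal-dealwise f-length w) ⟨
    Pointwise (IsEmbeddingIndex v) (deal (dealwise f w)) (pileIndices j)
      ∼⟨ ⇔.sym (embedding-stretch v (dealwise f w) j) ⟩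
    IsEmbeddingIndex (stretch (suc k) v) (dealwise f w) j
      ∎
    where open EquationalReasoning

theorem5p3 : (u v : Word) → length u ≡ length v → u ∼s v →
    (k : ℕ) → stretch (suc k) u ∼s stretch (suc k) v
theorem5p3 u v _ (f , f-weight , f-embedding) k =
  ↔⇒⤖ (dealwise-↔ (⤖⇒↔ f) f-length) ,
  weight-dealwise f-weight ,
  embedding-stretch-dealwise f-length f-embedding
  where
  open Dealing k
  f-length : ∀ w → length (Bijection.to f w) ≡ length w
  f-length = cong proj₁ ∘ f-weight
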